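{- Let $k\ge 1$ and let $\mathfrak{A}$ be a structure over $\Sigma^{(k)}$. Then $\mathfrak{A}$ satisfies every equation in $\Gamma^{(k)}$ if and only if $\mathfrak{A}\in\mathrm{I}(k\text{ -TUPLE})$, i.e., $\mathfrak{A}$ is isomorphic to $\mathfrak{B}^{(k)}$ for some structure $\mathfrak{B}$ over $\Sigma$.
   Context: $\Sigma$ is a countably infinite set of binary symbols. A structure $\mathfrak{A}$ over a set $A$: a non-empty set $|\mathfrak{A}|$ with $a^{\mathfrak{A}}\subseteq|\mathfrak{A}|^2$ for each $a\in A$; isomorphism is the usual notion (bijection preserving and reflecting every relation). CoR terms over $A$: $t::=a\mid\mathsf{I}\mid t^-\mid t\cap s\mid t\cdot s\mid t^{\smile}$ ($a\in A$), denoting relations: $a^{\mathfrak{A}}$, identity, complement in $|\mathfrak{A}|^2$, intersection, composition, converse; $t\cup s:=(t^-\cap s^-)^-$, $\top:=\mathsf{I}\cup\mathsf{I}^-$ (full relation). $t=s$ holds in $\mathfrak{A}$ if both sides denote the same relation; $t\le s$ abbreviates $t\cup s=s$ (inclusion). $\Sigma^{(k)}:=\Sigma\cup\{U\}\cup\{\pi_i,Q_i,E_{[1,i]},E_{[i,k]}\mid 1\le i\le k\}$ (fresh symbols). For a structure $\mathfrak{B}$ over $\Sigma$, its $k$-tuple structure $\mathfrak{B}^{(k)}$ over $\Sigma^{(k)}$ has universe $|\mathfrak{B}|^k$ and: $a^{\mathfrak{B}^{(k)}}=\{((v,\dots,v),(w,\dots,w))\mid (v,w)\in a^{\mathfrak{B}}\}$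 for $a\in\Sigma$; $U^{\mathfrak{B}^{(k)}}=\{((v,\dots,v),(v,\dots,v))\mid v\in|\mathfrak{B}|\}$; $\pi_i^{\mathfrak{B}^{(k)}}=\{((v_1,\dots,v_k),(v_i,\dots,v_i))\}$; $Q_i^{\mathfrak{B}^{(k)}}=\{((v_1,\dots,v_k),(v'_1,\dots,v'_k))\mid v_j=v'_j\text{ for all }j\ne i\}$; $E_{[i,i']}^{\mathfrak{B}^{(k)}}=\{((v_1,\dots,v_k),(v'_1,\dots,v'_k))\mid v_j=v'_j\text{ for all }i\le j\le i'\}$. $\mathrm{I}(k\text{ -TUPLE})$ is the class of structures isomorphic to some $\mathfrak{B}^{(k)}$. $\Gamma^{(k)}$ is the set of the following equations, for all $1\le i\le k$ and all $a\in\Sigma$, where $E_{[1,0]}$ and $E_{[k+1,k]}$ denote $\top$: $U=\bigcap_{1\le j\le k}\pi_j$; $E_{[1,i]}=E_{[1,i-1]}\cap(\pi_i\cdot\pi_i^{\smile})$; $E_{[i,k]}=E_{[i+1,k]}\cap(\pi_i\cdot\pi_i^{\smile})$; $Q_i=E_{[1,i-1]}\cap E_{[i+1,k]}$; $U\le\mathsf{I}$; $\pi_i^{\smile}\cdot\pi_i\le\mathsf{I}$; $\mathsf{I}\le\pi_i\cdot U\cdot\pi_i^{\smile}$; $\top\cdot U\le Q_i\cdot\pi_i$; $\mathsf{I}=E_{[1,k]}$; $\top\cdot U\cdot\top=\top$; $a\le U\cdot\top\cdot U$. -}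

module Defs where

open import Level using (0ℓ)
open import Data.Nat as ℕ using (ℕ; zero; suc)
open import Data.Fin as Fin using (Fin; zero; suc; inject₁; fromℕ)
open import Data.Maybe using (Maybe; just; nothing)
import Data.Maybe as Maybe
open import Data.Vec using (Vec; lookup; replicate)
open import Data.Product using (Σ; Σ-syntax; ∃; ∃-syntax; _×_; _,_)
open import Relation.Nullary using (¬_)
open import Relation.Binary.PropositionalEquality using (_≡_; _≢_)
open import Function.Bundles using (_⇔_; _⤖_; Bijection)

record Structure (A : Set) : Set₁ where
  field
    Carrier : Set
    point   : Carrier                       -- non-emptiness
    rel     : A → Carrier → Carrier → Set

open Structure public

record _≅_ {A : Set} (𝔄 𝔅 : Structure A) : Set where
  field
    bij  : Carrier 𝔄 ⤖ Carrier 𝔅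
  open Bijection bij public using (to)
  field
    pres : ∀ (a : A) (x y : Carrier 𝔄) → rel 𝔄 a x y ⇔ rel 𝔅 a (to x) (to y)

infixl 7 _∩_
infixl 8 _·_
infix 9 _⁻ _˘

data Term (A : Set) : Set where
  atom : A → Term A
  I    : Term A
  _⁻   : Term A → Term A
  _∩_  : Term A → Term A → Term A
  _·_  : Term A → Term A → Term A
  _˘   : Term A → Term A

_∪_ : ∀ {A} → Term A → Term A → Term A
t ∪ s = ((t ⁻) ∩ (s ⁻)) ⁻

⊤ : ∀ {A} → Term A
⊤ = I ∪ (I ⁻)

⟦_⟧ : ∀ {A} → Term A → (𝔄 : Structure A) → Carrier 𝔄 → Carrier 𝔄 → Set
⟦ atom a ⟧ 𝔄 x y = rel 𝔄 a x y
⟦ I ⟧ 𝔄 x y = x ≡ y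
⟦ t ⁻ ⟧ 𝔄 x y = ¬ ⟦ t ⟧ 𝔄 x y
⟦ t ∩ s ⟧ 𝔄 x y = ⟦ t ⟧ 𝔄 x y × ⟦ s ⟧ 𝔄 x y
⟦ t · s ⟧ 𝔄 x y = Σ[ z ∈ Carrier 𝔄 ] (⟦ t ⟧ 𝔄 x z × ⟦ s ⟧ 𝔄 z y)
⟦ t ˘ ⟧ 𝔄 x y = ⟦ t ⟧ 𝔄 y x

_⊨_≐_ : ∀ {A} → Structure A → Term A → Term A → Set
𝔄 ⊨ t ≐ s = ∀ x y → ⟦ t ⟧ 𝔄 x y ⇔ ⟦ s ⟧ 𝔄 x y

-- The signature Σ^(k), with k = suc n (so k ≥ 1); Σ = ℕ, indices
-- 1..k are represented 0-based by Fin k.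
-- The symbol E_[1,k] is simultaneously E_[1,i] (i = k) and E_[i,k]
-- (i = 1); it is represented only once, as El (fromℕ n).

data Sym (n : ℕ) : Set where
  base : ℕ → Sym n
  U    : Sym n
  π    : Fin (suc n) → Sym n
  Q    : Fin (suc n) → Sym n
  El   : Fin (suc n) → Sym n
  Er'  : Fin n → Sym n             -- E_[j+2,k]     (i = j+2 = 2..k)

Er : ∀ {n} → Fin (suc n) → Sym n
Er {n} zero = El (fromℕ n)
Er (suc j)  = Er' j

next : ∀ {n} → Fin (suc n) → Maybe (Fin (suc n))
next {zero}  zero    = nothing
next {suc n} zero    = just (suc zero)
next {suc n} (suc i) = Maybe.map suc (next {n} i)

ElPrev : ∀ {n} → Fin (suc n) → Term (Sym n)
ElPrev zero    = ⊤
ElPrev (suc j) = atom (El (inject₁ j))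

ErNext : ∀ {n} → Fin (suc n) → Term (Sym n)
ErNext i with next i
... | nothing = ⊤
... | just i' = atom (Er i')

⋂ : ∀ {n} {A : Set} → (Fin (suc n) → Term A) → Term A
⋂ {zero}  f = f zero
⋂ {suc n} f = f zero ∩ ⋂ {n} (λ j → f (suc j))

-- The equation set Γ^(k): InΓ n t s means "t = s" belongs to Γ^(suc n).
-- An inclusion t ≤ s abbreviates t ∪ s = s.

data InΓ (n : ℕ) : Term (Sym n) → Term (Sym n) → Set where
  eqU    : InΓ n (atom U) (⋂ (λ j → atom (π j)))
  eqEl   : ∀ i → InΓ n (atom (El i)) (ElPrev i ∩ (atom (π i) · (atom (π i) ˘)))
  eqEr   : ∀ i → InΓ n (atom (Er i)) (ErNext i ∩ (atom (π i) · (atom (π i) ˘)))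
  eqQ    : ∀ i → InΓ n (atom (Q i)) (ElPrev i ∩ ErNext i)
  leU    : InΓ n (atom U ∪ I) I
  leπ    : ∀ i → InΓ n (((atom (π i) ˘) · atom (π i)) ∪ I) I
  leπUπ  : ∀ i → InΓ n (I ∪ ((atom (π i) · atom U) · (atom (π i) ˘)))
                        ((atom (π i) · atom U) · (atom (π i) ˘))
  leQπ   : ∀ i → InΓ n ((⊤ · atom U) ∪ (atom (Q i) · atom (π i)))
                        (atom (Q i) · atom (π i))
  eqI    : InΓ n I (atom (El (fromℕ n)))
  eqTUT  : InΓ n ((⊤ · atom U) · ⊤) ⊤
  leBase : ∀ a → InΓ n (atom (base a) ∪ ((atom U · ⊤) · atom U))
                        ((atom U · ⊤) · atom U)

Sat-Γ : ∀ n → Structure (Sym n) → Set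
Sat-Γ n 𝔄 = ∀ {t s} → InΓ n t s → 𝔄 ⊨ t ≐ s

tupleRel : ∀ n (𝔅 : Structure ℕ) → Sym n →
           Vec (Carrier 𝔅) (suc n) → Vec (Carrier 𝔅) (suc n) → Set
tupleRel n 𝔅 (base a) x y =
  Σ[ v ∈ Carrier 𝔅 ] Σ[ w ∈ Carrier 𝔅 ]
    (x ≡ replicate (suc n) v × y ≡ replicate (suc n) w × rel 𝔅 a v w)
tupleRel n 𝔅 U x y =
  Σ[ v ∈ Carrier 𝔅 ] (x ≡ replicate (suc n) v × y ≡ replicate (suc n) v)
tupleRel n 𝔅 (π i) x y = y ≡ replicate (suc n) (lookup x i)
tupleRel n 𝔅 (Q i) x y = ∀ j → j ≢ i → lookup x j ≡ lookup y j
tupleRel n 𝔅 (El i) x y = ∀ j → j Fin.≤ i → lookup x j ≡ lookup y j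
tupleRel n 𝔅 (Er' j) x y = ∀ m → suc j Fin.≤ m → lookup x m ≡ lookup y m

tuple : ∀ n → Structure ℕ → Structure (Sym n)
tuple n 𝔅 = record
  { Carrier = Vec (Carrier 𝔅) (suc n)
  ; point   = replicate (suc n) (point 𝔅)
  ; rel     = tupleRel n 𝔅
  }

InIkTuple : ∀ n → Structure (Sym n) → Set₁
InIkTuple n 𝔄 = Σ[ 𝔅 ∈ Structure ℕ ] (𝔄 ≅ tuple n 𝔅)

-- In a model of Γ^(k) every π_i is a total function whose values are U-points, and U is the set of
-- points fixed by all π_j. Writing π_i x for the i-th coordinate of x, induction along the index
-- shows that the equations for E_[1,i], E_[i,k] and Q_i force them to be agreement on the
-- coordinates in [1,i], in [i,k], and outside i. Then E_[1,k] = I makes x ↦ (π_1 x, …, π_k x)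
-- injective, Q_i · π_i ⊇ ⊤ · U lets one overwrite a single coordinate by any U-point, so the map
-- is onto the k-tuples of U-points, and a ≤ U · ⊤ · U confines the Σ-relations to U-points: the
-- map is an isomorphism onto 𝔅^(k), where 𝔅 is the U-points with the Σ-relations. Conversely
-- 𝔅^(k) satisfies Γ^(k) by computation; excluded middle is needed there because an inclusion
-- t ≤ s unfolds to ¬¬-elimination for s.
module Submission where

open import Defs
open import Level using (0ℓ)
open import Data.Nat using (ℕ; suc)
open import Function.Bundles using (_⇔_)
open import Axiom.ExcludedMiddle using (ExcludedMiddle)

open import Axiom.UniquenessOfIdentityProofs.WithK using (uip)
open import Data.Empty using (⊥-elim)
open import Data.Fin as Fin using (Fin; zero; suc; inject₁; fromℕ; toℕ; _≤_; _<_)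
open import Data.Fin.Induction using (<-weakInduction; >-weakInduction)
import Data.Fin.Properties as Finₚ
open import Data.Fin.Relation.Unary.Top using (view; ‵fromℕ; ‵inject₁)
open import Data.Maybe using (just; nothing)
import Data.Nat as ℕ
import Data.Nat.Properties as ℕₚ
open import Data.Product using (Σ-syntax; _×_; _,_; proj₁; proj₂)
open import Data.Product.Function.NonDependent.Propositional using (_×-⇔_)
open import Data.Vec using (Vec; head; lookup; replicate; tabulate; _[_]≔_)
open import Data.Vec.Properties
  using (lookup-replicate; lookup∘tabulate; lookup∘update; lookup∘update′)
open import Data.Vec.Relation.Binary.Pointwise.Extensional using (ext; Pointwise-≡⇒≡)
open import Function.Base using (_∘_)
open import Function.Bundles using (mk⇔; mk⤖; Bijection; module Equivalence)
import Function.Properties.Equivalence as ⇔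
open import Relation.Binary.Core using (Rel; _⇒_)
open import Relation.Binary.Definitions using (tri<; tri≈; tri>)
open import Relation.Binary.PropositionalEquality
open import Relation.Nullary using (yes; no)

open Equivalence using (to; from)

infix 4 _≋_

_≋_ : ∀ {C : Set} → Rel C 0ℓ → Rel C 0ℓ → Set
R ≋ S = ∀ x y → R x y ⇔ S x y

≋-sym : ∀ {C} {R S : Rel C 0ℓ} → R ≋ S → S ≋ R
≋-sym e x y = ⇔.sym (e x y)

≋-trans : ∀ {C} {R S T : Rel C 0ℓ} → R ≋ S → S ≋ T → R ≋ T
≋-trans e f x y = ⇔.trans (e x y) (f x y)

module _ {A : Set} (𝔄 : Structure A) where

  ⊤-full : ∀ x y → ⟦ ⊤ ⟧ 𝔄 x y
  ⊤-full x y (x≢y , ¬x≢y) = ¬x≢y x≢y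

  ⟦⋂⟧ : ∀ {n} (f : Fin (suc n) → Term A) → ⟦ ⋂ f ⟧ 𝔄 ≋ λ x y → ∀ j → ⟦ f j ⟧ 𝔄 x y
  ⟦⋂⟧ {ℕ.zero} f x y = mk⇔ (λ { r zero → r }) (λ r → r zero)
  ⟦⋂⟧ {suc n} f x y = ⇔.trans (⇔.refl ×-⇔ ⟦⋂⟧ (λ j → f (suc j)) x y)
    (mk⇔ (λ { (r , rs) zero → r ; (r , rs) (suc j) → rs j }) (λ rs → rs zero , λ j → rs (suc j)))

  ≤⇒⊆ : ∀ {t s} → 𝔄 ⊨ t ∪ s ≐ s → ⟦ t ⟧ 𝔄 ⇒ ⟦ s ⟧ 𝔄
  ≤⇒⊆ t≤s {x} {y} r = to (t≤s x y) (λ (¬r , _) → ¬r r)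

  ⊆⇒≤ : ExcludedMiddle 0ℓ → ∀ t s → ⟦ t ⟧ 𝔄 ⇒ ⟦ s ⟧ 𝔄 → 𝔄 ⊨ t ∪ s ≐ s
  ⊆⇒≤ em t s t⊆s x y = mk⇔ double-negation (λ r (_ , ¬r) → ¬r r)
    where
    double-negation : ⟦ t ∪ s ⟧ 𝔄 x y → ⟦ s ⟧ 𝔄 x y
    double-negation ¬¬r with em {⟦ s ⟧ 𝔄 x y}
    ... | yes r = r
    ... | no ¬r = ⊥-elim (¬¬r ((λ r → ¬r (t⊆s r)) , ¬r))

module _ {A : Set} {𝔄 𝔅 : Structure A} (iso : 𝔄 ≅ 𝔅) where
  open _≅_ iso using (bij; pres) renaming (to to f)

  ⟦⟧-≅ : ∀ t x y → ⟦ t ⟧ 𝔄 x y ⇔ ⟦ t ⟧ 𝔅 (f x) (f y)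
  ⟦⟧-≅ (atom a) = pres a
  ⟦⟧-≅ I x y = mk⇔ (cong f) (Bijection.injective bij)
  ⟦⟧-≅ (t ⁻) x y =
    mk⇔ (λ ¬r r → ¬r (from (⟦⟧-≅ t x y) r)) (λ ¬r r → ¬r (to (⟦⟧-≅ t x y) r))
  ⟦⟧-≅ (t ∩ s) x y = ⟦⟧-≅ t x y ×-⇔ ⟦⟧-≅ s x y
  ⟦⟧-≅ (t · s) x y =
    mk⇔ (λ (z , r , r′) → f z , to (⟦⟧-≅ t x z) r , to (⟦⟧-≅ s z y) r′) reflect
    where
    reflect : ⟦ t · s ⟧ 𝔅 (f x) (f y) → ⟦ t · s ⟧ 𝔄 x y
    reflect (z , r , r′) with Bijection.surjective bij z
    ... | w , fw≡z = w , from (⟦⟧-≅ t x w) (subst (⟦ t ⟧ 𝔅 (f x)) (sym (fw≡z refl)) r)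
                       , from (⟦⟧-≅ s w y) (subst (λ v → ⟦ s ⟧ 𝔅 v (f y)) (sym (fw≡z refl)) r′)
  ⟦⟧-≅ (t ˘) x y = ⟦⟧-≅ t y x

  ⊨-≅ : ∀ t s → 𝔅 ⊨ t ≐ s → 𝔄 ⊨ t ≐ s
  ⊨-≅ t s t≐s x y =
    ⇔.trans (⟦⟧-≅ t x y) (⇔.trans (t≐s (f x) (f y)) (⇔.sym (⟦⟧-≅ s x y)))

module _ {k} (R : Fin k → Set) where

  ∀≤-split : ∀ i → (∀ m → m ≤ i → R m) ⇔ ((∀ m → m < i → R m) × R i)
  ∀≤-split i = mk⇔ (λ r → (λ m m<i → r m (ℕₚ.<⇒≤ m<i)) , r i Finₚ.≤-refl) join
    where
    join : (∀ m → m < i → R m) × R i → ∀ m → m ≤ i → R m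
    join (below , at) m m≤i with m Fin.≟ i
    ... | yes refl = at
    ... | no m≢i = below m (Finₚ.≤∧≢⇒< m≤i m≢i)

  ∀≥-split : ∀ i → (∀ m → i ≤ m → R m) ⇔ ((∀ m → i < m → R m) × R i)
  ∀≥-split i = mk⇔ (λ r → (λ m i<m → r m (ℕₚ.<⇒≤ i<m)) , r i Finₚ.≤-refl) join
    where
    join : (∀ m → i < m → R m) × R i → ∀ m → i ≤ m → R m
    join (above , at) m i≤m with i Fin.≟ m
    ... | yes refl = at
    ... | no i≢m = above m (Finₚ.≤∧≢⇒< i≤m i≢m)

  ∀≢-split : ∀ i → (∀ m → m ≢ i → R m) ⇔ ((∀ m → m < i → R m) × (∀ m → i < m → R m))
  ∀≢-split i = mk⇔ (λ r → (λ m m<i → r m (Finₚ.<⇒≢ m<i)) , (λ m i<m → r m (Finₚ.<⇒≢ i<m ∘ sym)))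
                   join
    where
    join : (∀ m → m < i → R m) × (∀ m → i < m → R m) → ∀ m → m ≢ i → R m
    join (below , above) m m≢i with Finₚ.<-cmp m i
    ... | tri< m<i _ _ = below m m<i
    ... | tri≈ _ m≡i _ = ⊥-elim (m≢i m≡i)
    ... | tri> _ _ i<m = above m i<m

module _ {n} (R : Fin (suc n) → Set) where

  ∀<suc : ∀ (j : Fin n) → (∀ m → m < suc j → R m) ⇔ (∀ m → m ≤ inject₁ j → R m)
  ∀<suc j = mk⇔
    (λ r m m≤j → r m (ℕ.s≤s (subst (toℕ m ℕ.≤_) (Finₚ.toℕ-inject₁ j) m≤j)))
    (λ r m m<1+j → r m (subst (toℕ m ℕ.≤_) (sym (Finₚ.toℕ-inject₁ j)) (ℕ.s≤s⁻¹ m<1+j)))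

  ∀>inject₁ : ∀ (j : Fin n) → (∀ m → inject₁ j < m → R m) ⇔ (∀ m → suc j ≤ m → R m)
  ∀>inject₁ j = mk⇔
    (λ r m 1+j≤m → r m (subst (λ l → suc l ℕ.≤ toℕ m) (sym (Finₚ.toℕ-inject₁ j)) 1+j≤m))
    (λ r m j<m → r m (subst (λ l → suc l ℕ.≤ toℕ m) (Finₚ.toℕ-inject₁ j) j<m))

  ∀>fromℕ : ∀ m → fromℕ n < m → R m
  ∀>fromℕ m n<m = ⊥-elim (ℕₚ.<⇒≱ n<m (Finₚ.≤fromℕ m))

next-fromℕ : ∀ n → next (fromℕ n) ≡ nothing
next-fromℕ ℕ.zero = refl
next-fromℕ (suc n) rewrite next-fromℕ n = refl

next-inject₁ : ∀ {n} (j : Fin n) → next (inject₁ j) ≡ just (suc j)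
next-inject₁ {suc n} zero = refl
next-inject₁ {suc n} (suc j) rewrite next-inject₁ j = refl

ErNext-fromℕ : ∀ n → ErNext (fromℕ n) ≡ ⊤
ErNext-fromℕ n rewrite next-fromℕ n = refl

ErNext-inject₁ : ∀ {n} (j : Fin n) → ErNext (inject₁ j) ≡ atom (Er (suc j))
ErNext-inject₁ j rewrite next-inject₁ j = refl

π·π˘ : ∀ {n} → Fin (suc n) → Term (Sym n)
π·π˘ i = atom (π i) · atom (π i) ˘

module Agreement {n} (𝔄 : Structure (Sym n)) (P : Fin (suc n) → Rel (Carrier 𝔄) 0ℓ)
                 (kernel : ∀ i → ⟦ π·π˘ i ⟧ 𝔄 ≋ P i) where

  Agree : (Fin (suc n) → Set) → Rel (Carrier 𝔄) 0ℓ
  Agree S x y = ∀ m → S m → P m x y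

  ElSpec ErSpec QSpec : Fin (suc n) → Set
  ElSpec i = ⟦ atom (El i) ⟧ 𝔄 ≋ Agree (_≤ i)
  ErSpec i = ⟦ atom (Er i) ⟧ 𝔄 ≋ Agree (i ≤_)
  QSpec i = ⟦ atom (Q i) ⟧ 𝔄 ≋ Agree (_≢ i)

  ElPrev-zero-agree : ⟦ ElPrev zero ⟧ 𝔄 ≋ Agree (_< zero {n})
  ElPrev-zero-agree x y = mk⇔ (λ _ m ()) (λ _ → ⊤-full 𝔄 x y)

  ElPrev-suc-agree : ∀ j → ElSpec (inject₁ j) → ⟦ ElPrev (suc j) ⟧ 𝔄 ≋ Agree (_< suc j)
  ElPrev-suc-agree j spec x y = ⇔.trans (spec x y) (⇔.sym (∀<suc (λ m → P m x y) j))

  ErNext-fromℕ-agree : ⟦ ErNext (fromℕ n) ⟧ 𝔄 ≋ Agree (fromℕ n <_)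
  ErNext-fromℕ-agree x y rewrite ErNext-fromℕ n =
    mk⇔ (λ _ → ∀>fromℕ (λ m → P m x y)) (λ _ → ⊤-full 𝔄 x y)

  ErNext-inject₁-agree : ∀ j → ErSpec (suc j) → ⟦ ErNext (inject₁ j) ⟧ 𝔄 ≋ Agree (inject₁ j <_)
  ErNext-inject₁-agree j spec x y rewrite ErNext-inject₁ j =
    ⇔.trans (spec x y) (⇔.sym (∀>inject₁ (λ m → P m x y) j))

  ElPrev-agree : (∀ i → ElSpec i) → ∀ i → ⟦ ElPrev i ⟧ 𝔄 ≋ Agree (_< i)
  ElPrev-agree El≋ zero = ElPrev-zero-agree
  ElPrev-agree El≋ (suc j) = ElPrev-suc-agree j (El≋ (inject₁ j))

  ErNext-agree : (∀ i → ErSpec i) → ∀ i → ⟦ ErNext i ⟧ 𝔄 ≋ Agree (i <_)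
  ErNext-agree Er≋ i with view i
  ... | ‵fromℕ = ErNext-fromℕ-agree
  ... | ‵inject₁ j = ErNext-inject₁-agree j (Er≋ (suc j))

  El-body : ∀ i → ⟦ ElPrev i ⟧ 𝔄 ≋ Agree (_< i) → ⟦ ElPrev i ∩ π·π˘ i ⟧ 𝔄 ≋ Agree (_≤ i)
  El-body i prev x y =
    ⇔.trans (prev x y ×-⇔ kernel i x y) (⇔.sym (∀≤-split (λ m → P m x y) i))

  Er-body : ∀ i → ⟦ ErNext i ⟧ 𝔄 ≋ Agree (i <_) → ⟦ ErNext i ∩ π·π˘ i ⟧ 𝔄 ≋ Agree (i ≤_)
  Er-body i next x y =
    ⇔.trans (next x y ×-⇔ kernel i x y) (⇔.sym (∀≥-split (λ m → P m x y) i))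

  Q-body : (∀ i → ElSpec i) → (∀ i → ErSpec i) →
           ∀ i → ⟦ ElPrev i ∩ ErNext i ⟧ 𝔄 ≋ Agree (_≢ i)
  Q-body El≋ Er≋ i x y =
    ⇔.trans (ElPrev-agree El≋ i x y ×-⇔ ErNext-agree Er≋ i x y)
            (⇔.sym (∀≢-split (λ m → P m x y) i))

  module _ (sat : Sat-Γ n 𝔄) where

    El-spec : ∀ i → ElSpec i
    El-spec = <-weakInduction ElSpec
      (≋-trans (sat (eqEl zero)) (El-body zero ElPrev-zero-agree))
      (λ j spec → ≋-trans (sat (eqEl (suc j))) (El-body (suc j) (ElPrev-suc-agree j spec)))

    Er-spec : ∀ i → ErSpec i
    Er-spec = >-weakInduction ErSpec
      (≋-trans (sat (eqEr (fromℕ n))) (Er-body (fromℕ n) ErNext-fromℕ-agree))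
      (λ j spec → ≋-trans (sat (eqEr (inject₁ j)))
                          (Er-body (inject₁ j) (ErNext-inject₁-agree j spec)))

    Q-spec : ∀ i → QSpec i
    Q-spec i = ≋-trans (sat (eqQ i)) (Q-body El-spec Er-spec i)

  module _ (El≋ : ∀ i → ElSpec i) (Er≋ : ∀ i → ErSpec i) where

    El-equation : ∀ i → 𝔄 ⊨ atom (El i) ≐ (ElPrev i ∩ π·π˘ i)
    El-equation i = ≋-trans (El≋ i) (≋-sym (El-body i (ElPrev-agree El≋ i)))

    Er-equation : ∀ i → 𝔄 ⊨ atom (Er i) ≐ (ErNext i ∩ π·π˘ i)
    Er-equation i = ≋-trans (Er≋ i) (≋-sym (Er-body i (ErNext-agree Er≋ i)))

    Q-equation : ∀ i → QSpec i → 𝔄 ⊨ atom (Q i) ≐ (ElPrev i ∩ ErNext i)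
    Q-equation i Q≋ = ≋-trans Q≋ (≋-sym (Q-body El≋ Er≋ i))

module _ (em : ExcludedMiddle 0ℓ) (n : ℕ) (𝔅 : Structure ℕ) where

  private
    𝕋 : Structure (Sym n)
    𝕋 = tuple n 𝔅

    rep : Carrier 𝔅 → Vec (Carrier 𝔅) (suc n)
    rep = replicate (suc n)

  coordinate-kernel : ∀ i → ⟦ π·π˘ i ⟧ 𝕋 ≋ λ x y → lookup x i ≡ lookup y i
  coordinate-kernel i x y = mk⇔ (λ (z , z≡x , z≡y) → cong head (trans (sym z≡x) z≡y))
                                (λ xᵢ≡yᵢ → rep (lookup x i) , refl , cong rep xᵢ≡yᵢ)

  open Agreement 𝕋 (λ i x y → lookup x i ≡ lookup y i) coordinate-kernel

  tuple-Er-spec : ∀ i → ErSpec i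
  tuple-Er-spec zero x y = mk⇔ (λ r m _ → r m (Finₚ.≤fromℕ m)) (λ r m _ → r m ℕ.z≤n)
  tuple-Er-spec (suc j) x y = ⇔.refl

  tuple-satisfies-Γ : Sat-Γ n 𝕋
  tuple-satisfies-Γ eqU x y =
    ⇔.trans (mk⇔ U⇒constant constant⇒U) (⇔.sym (⟦⋂⟧ 𝕋 (λ j → atom (π j)) x y))
    where
    U⇒constant : rel 𝕋 U x y → ∀ j → y ≡ rep (lookup x j)
    U⇒constant (v , refl , refl) j = cong rep (sym (lookup-replicate j v))
    constant⇒U : (∀ j → y ≡ rep (lookup x j)) → rel 𝕋 U x y
    constant⇒U y≡ = lookup x zero
                  , Pointwise-≡⇒≡ (ext λ j → trans (cong head (trans (sym (y≡ j)) (y≡ zero)))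
                                                    (sym (lookup-replicate j (lookup x zero))))
                  , y≡ zero
  tuple-satisfies-Γ (eqEl i) = El-equation (λ _ _ _ → ⇔.refl) tuple-Er-spec i
  tuple-satisfies-Γ (eqEr i) = Er-equation (λ _ _ _ → ⇔.refl) tuple-Er-spec i
  tuple-satisfies-Γ (eqQ i) = Q-equation (λ _ _ _ → ⇔.refl) tuple-Er-spec i (λ _ _ → ⇔.refl)
  tuple-satisfies-Γ leU = ⊆⇒≤ 𝕋 em (atom U) I λ (_ , x≡ , y≡) → trans x≡ (sym y≡)
  tuple-satisfies-Γ (leπ i) =
    ⊆⇒≤ 𝕋 em (atom (π i) ˘ · atom (π i)) I λ (_ , x≡ , y≡) → trans x≡ (sym y≡)
  tuple-satisfies-Γ (leπUπ i) = ⊆⇒≤ 𝕋 em I ((atom (π i) · atom U) · atom (π i) ˘) λ { {x} refl →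
    rep (lookup x i) , (rep (lookup x i) , refl , (lookup x i , refl , refl)) , refl }
  tuple-satisfies-Γ (leQπ i) =
    ⊆⇒≤ 𝕋 em (⊤ · atom U) (atom (Q i) · atom (π i)) λ { {x} (_ , _ , v , _ , y≡) →
      x [ i ]≔ v , (λ j j≢i → sym (lookup∘update′ j≢i x v))
                 , trans y≡ (cong rep (sym (lookup∘update i x v))) }
  tuple-satisfies-Γ eqI x y =
    mk⇔ (λ { refl _ _ → refl }) (λ r → Pointwise-≡⇒≡ (ext λ j → r j (Finₚ.≤fromℕ j)))
  tuple-satisfies-Γ eqTUT x y = mk⇔ (λ _ → ⊤-full 𝕋 x y) λ _ →
    rep (point 𝔅) , (rep (point 𝔅) , ⊤-full 𝕋 x _ , (point 𝔅 , refl , refl)) , ⊤-full 𝕋 _ y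
  tuple-satisfies-Γ (leBase a) = ⊆⇒≤ 𝕋 em (atom (base a)) ((atom U · ⊤) · atom U)
    λ { {x} {y} (v , w , x≡ , y≡ , _) → y , (x , (v , x≡ , x≡) , ⊤-full 𝕋 x y) , (w , y≡ , y≡) }

module Reconstruction {n} (𝔄 : Structure (Sym n)) (sat : Sat-Γ n 𝔄) where

  private
    C : Set
    C = Carrier 𝔄

  Γ-inclusion : ∀ {t s} → InΓ n (t ∪ s) s → ⟦ t ⟧ 𝔄 ⇒ ⟦ s ⟧ 𝔄
  Γ-inclusion {t} {s} γ = ≤⇒⊆ 𝔄 {t} {s} (sat γ)

  U⊆I : ∀ {x y} → rel 𝔄 U x y → x ≡ y
  U⊆I = Γ-inclusion leU

  U-reflˡ : ∀ {x y} → rel 𝔄 U x y → rel 𝔄 U x x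
  U-reflˡ {x} xUy = subst (rel 𝔄 U x) (sym (U⊆I xUy)) xUy

  U-reflʳ : ∀ {x y} → rel 𝔄 U x y → rel 𝔄 U y y
  U-reflʳ {y = y} xUy = subst (λ z → rel 𝔄 U z y) (U⊆I xUy) xUy

  π-functional : ∀ i {x y y′} → rel 𝔄 (π i) x y → rel 𝔄 (π i) x y′ → y ≡ y′
  π-functional i xπy xπy′ = Γ-inclusion (leπ i) (_ , xπy , xπy′)

  π-total : ∀ i x → Σ[ y ∈ C ] rel 𝔄 (π i) x y × rel 𝔄 U y y
  π-total i x with Γ-inclusion (leπUπ i) {x} refl
  ... | _ , (y , xπy , yUz) , _ = y , xπy , U-reflˡ yUz

  U⊆π : ∀ {z} → rel 𝔄 U z z → ∀ i → rel 𝔄 (π i) z z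
  U⊆π {z} zUz = to (⟦⋂⟧ 𝔄 (λ j → atom (π j)) z z) (to (sat eqU z z) zUz)

  proj : Fin (suc n) → C → C
  proj i x = proj₁ (π-total i x)

  proj-π : ∀ i x → rel 𝔄 (π i) x (proj i x)
  proj-π i x = proj₁ (proj₂ (π-total i x))

  proj-U : ∀ i x → rel 𝔄 U (proj i x) (proj i x)
  proj-U i x = proj₂ (proj₂ (π-total i x))

  π⇒proj : ∀ {i x y} → rel 𝔄 (π i) x y → proj i x ≡ y
  π⇒proj {i} = π-functional i (proj-π i _)

  proj-fixes-U : ∀ {i z} → rel 𝔄 U z z → proj i z ≡ z
  proj-fixes-U {i} zUz = π⇒proj (U⊆π zUz i)

  proj-kernel : ∀ i → ⟦ π·π˘ i ⟧ 𝔄 ≋ λ x y → proj i x ≡ proj i y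
  proj-kernel i x y = mk⇔
    (λ (_ , xπz , yπz) → trans (π⇒proj xπz) (sym (π⇒proj yπz)))
    (λ e → proj i x , proj-π i x , subst (rel 𝔄 (π i) y) (sym e) (proj-π i y))

  open Agreement 𝔄 (λ i x y → proj i x ≡ proj i y) proj-kernel

  proj-injective : ∀ {x y} → (∀ i → proj i x ≡ proj i y) → x ≡ y
  proj-injective {x} {y} e = from (sat eqI x y) (from (El-spec sat (fromℕ n) x y) λ m _ → e m)

  replace : ∀ i x {u} → rel 𝔄 U u u → Σ[ z ∈ C ] Agree (_≢ i) x z × proj i z ≡ u
  replace i x {u} uUu with Γ-inclusion (leQπ i) (u , ⊤-full 𝔄 x u , uUu)
  ... | z , xQz , zπu = z , to (Q-spec sat i x z) xQz , π⇒proj zπu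

  prescribe : (f : Fin (suc n) → C) → (∀ i → rel 𝔄 U (f i) (f i)) →
              Σ[ x ∈ C ] ∀ i → proj i x ≡ f i
  prescribe f fU =
    let x , x≈f = <-weakInduction Prescribed first step (fromℕ n)
    in x , λ i → x≈f i (Finₚ.≤fromℕ i)
    where
    Prescribed : Fin (suc n) → Set
    Prescribed i = Σ[ x ∈ C ] ∀ m → m ≤ i → proj m x ≡ f m

    first : Prescribed zero
    first = let z , _ , z≈f = replace zero (point 𝔄) (fU zero)
            in z , from (∀≤-split _ zero) ((λ _ ()) , z≈f)

    step : ∀ j → Prescribed (inject₁ j) → Prescribed (suc j)
    step j (x , x≈f) =
      let z , x~z , z≈f = replace (suc j) x (fU (suc j))
          z≈f-below m m<1+j = trans (sym (x~z m (Finₚ.<⇒≢ m<1+j))) (from (∀<suc _ j) x≈f m m<1+j)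
      in z , from (∀≤-split _ (suc j)) (z≈f-below , z≈f)

  -- The U-points, recognised as fixed points of proj zero so that, by UIP, a point is determined
  -- by its element of 𝔄.
  Point : Set
  Point = Σ[ z ∈ C ] proj zero z ≡ z

  point-U : (u : Point) → rel 𝔄 U (proj₁ u) (proj₁ u)
  point-U (z , e) = subst (λ w → rel 𝔄 U w w) e (proj-U zero z)

  point-≡ : {u v : Point} → proj₁ u ≡ proj₁ v → u ≡ v
  point-≡ {z , e} {.z , e′} refl = cong (z ,_) (uip e e′)

  as-point : ∀ {z} → rel 𝔄 U z z → Point
  as-point zUz = _ , proj-fixes-U zUz

  𝔅 : Structure ℕ
  𝔅 = record
    { Carrier = Point
    ; point   = as-point (proj-U zero (point 𝔄))
    ; rel     = λ a u v → rel 𝔄 (base a) (proj₁ u) (proj₁ v)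
    }

  coords : C → Vec Point (suc n)
  coords x = tabulate λ i → as-point (proj-U i x)

  lookup-coords : ∀ x i → lookup (coords x) i ≡ as-point (proj-U i x)
  lookup-coords x = lookup∘tabulate (λ i → as-point (proj-U i x))

  coords-agree-at : ∀ i x y → (lookup (coords x) i ≡ lookup (coords y) i) ⇔ (proj i x ≡ proj i y)
  coords-agree-at i x y rewrite lookup-coords x i | lookup-coords y i = mk⇔ (cong proj₁) point-≡

  coords-agree : ∀ S x y → Agree S x y ⇔ (∀ m → S m → lookup (coords x) m ≡ lookup (coords y) m)
  coords-agree S x y = mk⇔ (λ x~y m s → from (coords-agree-at m x y) (x~y m s))
                           (λ x~y m s → to (coords-agree-at m x y) (x~y m s))

  coords-injective : ∀ {x y} → coords x ≡ coords y → x ≡ y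
  coords-injective {x} {y} e =
    proj-injective λ i → to (coords-agree-at i x y) (cong (λ v → lookup v i) e)

  coords-surjective : ∀ v → Σ[ x ∈ C ] ∀ {z} → z ≡ x → coords z ≡ v
  coords-surjective v =
    let x , x≈v = prescribe (λ i → proj₁ (lookup v i)) (λ i → point-U (lookup v i))
    in x , λ { refl → Pointwise-≡⇒≡ (ext λ i → trans (lookup-coords x i) (point-≡ (x≈v i))) }

  coords-replicate : (u : Point) → coords (proj₁ u) ≡ replicate (suc n) u
  coords-replicate u = Pointwise-≡⇒≡ (ext λ i →
    trans (lookup-coords (proj₁ u) i)
          (trans (point-≡ (proj-fixes-U (point-U u))) (sym (lookup-replicate i u))))

  coords≡replicate : ∀ {x} (u : Point) → coords x ≡ replicate (suc n) u ⇔ x ≡ proj₁ u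
  coords≡replicate u = mk⇔ (λ e → coords-injective (trans e (sym (coords-replicate u))))
                           (λ { refl → coords-replicate u })

  coords-preserves : ∀ a x y → rel 𝔄 a x y ⇔ rel (tuple n 𝔅) a (coords x) (coords y)
  coords-preserves (base a) x y = mk⇔ preserve reflect
    where
    preserve : rel 𝔄 (base a) x y → rel (tuple n 𝔅) (base a) (coords x) (coords y)
    preserve xay with Γ-inclusion (leBase a) xay
    ... | _ , (_ , xUz , _) , zUy = as-point (U-reflˡ xUz) , as-point (U-reflʳ zUy)
                                  , coords-replicate _ , coords-replicate _ , xay
    reflect : rel (tuple n 𝔅) (base a) (coords x) (coords y) → rel 𝔄 (base a) x y
    reflect (u , v , x≡u , y≡v , uav) =
      subst₂ (rel 𝔄 (base a)) (sym (to (coords≡replicate u) x≡u))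
                              (sym (to (coords≡replicate v) y≡v)) uav
  coords-preserves U x y = mk⇔ preserve reflect
    where
    preserve : rel 𝔄 U x y → rel (tuple n 𝔅) U (coords x) (coords y)
    preserve xUy = as-point (U-reflˡ xUy) , coords-replicate _
                 , from (coords≡replicate _) (sym (U⊆I xUy))
    reflect : rel (tuple n 𝔅) U (coords x) (coords y) → rel 𝔄 U x y
    reflect (u , x≡u , y≡u) =
      subst₂ (rel 𝔄 U) (sym (to (coords≡replicate u) x≡u))
                       (sym (to (coords≡replicate u) y≡u)) (point-U u)
  coords-preserves (π i) x y rewrite lookup-coords x i =
    ⇔.trans (mk⇔ (sym ∘ π⇒proj) λ { refl → proj-π i x }) (⇔.sym (coords≡replicate _))
  coords-preserves (Q i) x y = ⇔.trans (Q-spec sat i x y) (coords-agree _ x y)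
  coords-preserves (El i) x y = ⇔.trans (El-spec sat i x y) (coords-agree _ x y)
  coords-preserves (Er' j) x y = ⇔.trans (Er-spec sat (suc j) x y) (coords-agree _ x y)

  coords-≅ : 𝔄 ≅ tuple n 𝔅
  coords-≅ = record
    { bij  = mk⤖ (coords-injective , coords-surjective)
    ; pres = coords-preserves
    }

lemma1 : ExcludedMiddle 0ℓ → (n : ℕ) (𝔄 : Structure (Sym n)) →
    Sat-Γ n 𝔄 ⇔ InIkTuple n 𝔄
lemma1 em n 𝔄 = mk⇔ reconstruct transfer
  where
  reconstruct : Sat-Γ n 𝔄 → InIkTuple n 𝔄
  reconstruct sat = Reconstruction.𝔅 𝔄 sat , Reconstruction.coords-≅ 𝔄 sat

  transfer : InIkTuple n 𝔄 → Sat-Γ n 𝔄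
  transfer (𝔅 , 𝔄≅𝔅ᵏ) {t} {s} γ = ⊨-≅ 𝔄≅𝔅ᵏ t s (tuple-satisfies-Γ em n 𝔅 γ)
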